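{- Let $d\ge 2$ and let $p$ be a prime with $(p,d)\neq(2,2)$. Let $G\le S_{p^d}$ be a transitive permutation group containing a cyclic transitive subgroup. Then $G$ does not contain a $p$-elementary-abelian regular normal subgroup. -}

module Defs where

open import Data.Nat using (ℕ; zero; suc)
open import Data.Fin using (Fin)
open import Data.Fin.Permutation using (Permutation′; _⟨$⟩ʳ_; id; flip; _∘ₚ_)
open import Data.Product using (Σ; ∃; _×_)
open import Relation.Binary.PropositionalEquality using (_≡_)

Perm : ℕ → Set
Perm n = Permutation′ n

_≈ₚ_ : ∀ {n} → Perm n → Perm n → Set
π ≈ₚ ρ = ∀ i → π ⟨$⟩ʳ i ≡ ρ ⟨$⟩ʳ i

-- Powers π^k (π ∘ₚ ρ means "first π, then ρ").
_^ₚ_ : ∀ {n} → Perm n → ℕ → Perm n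
π ^ₚ zero  = id
π ^ₚ suc k = π ∘ₚ (π ^ₚ k)

record IsSubgroup {n : ℕ} (H : Perm n → Set) : Set where
  field
    resp  : ∀ {π ρ} → π ≈ₚ ρ → H π → H ρ
    id∈   : H id
    ∘∈    : ∀ {π ρ} → H π → H ρ → H (π ∘ₚ ρ)
    inv∈  : ∀ {π} → H π → H (flip π)

_⊆ₚ_ : ∀ {n} → (Perm n → Set) → (Perm n → Set) → Set
H ⊆ₚ K = ∀ {π} → H π → K π

Transitive : ∀ {n} → (Perm n → Set) → Set
Transitive {n} H = ∀ (i j : Fin n) → Σ (Perm _) λ π → H π × π ⟨$⟩ʳ i ≡ j

Cyclic : ∀ {n} → (Perm n → Set) → Set
Cyclic {n} H = Σ (Perm n) λ σ → H σ × (∀ {π} → H π → Σ ℕ λ k → π ≈ₚ (σ ^ₚ k))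

Regular : ∀ {n} → (Perm n → Set) → Set
Regular {n} H = Transitive H × (∀ {π} → H π → ∀ (i : Fin n) → π ⟨$⟩ʳ i ≡ i → π ≈ₚ id)

Normal : ∀ {n} → (Perm n → Set) → (Perm n → Set) → Set
Normal N G = ∀ {g π} → G g → N π → N (flip g ∘ₚ (π ∘ₚ g))

ElementaryAbelian : ∀ {n} → ℕ → (Perm n → Set) → Set
ElementaryAbelian p N =
  (∀ {π ρ} → N π → N ρ → (π ∘ₚ ρ) ≈ₚ (ρ ∘ₚ π)) × (∀ {π} → N π → (π ^ₚ p) ≈ₚ id)

-- Let N be the regular elementary abelian normal subgroup. Fixing a point o, the regular action
-- identifies the points with N ≅ 𝔽_p^d (x + y := τ_x y, where τ_x ∈ N sends o to x). A generator σ
-- of the transitive cyclic subgroup lies in G, so it normalises N and acts affinely: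
-- σ (x + y) = b x + σ y with b linear. Homogenise: on pairs, σ becomes the linear map
-- M (x , y) = (b x + y , y) evaluated at (x , σ o), and M = 1 + E with
-- E^(k+1) (x , y) = (δ^(k+1) x + δ^k y , 0), where δ = b - 1. Since the exponent is p, Frobenius gives
-- M^(p^e) = 1 + E^(p^e). As σ is a p^d-cycle, σ^(p^d) = 1 forces δ to be nilpotent, hence δ^d = 0
-- (a nilpotent endomorphism of 𝔽_p^d). Then E^(p^e) = 0 as soon as p^e > d; e = d - 1 works exactly
-- when (p , d) ≠ (2 , 2), and σ^(p^(d-1)) = 1 contradicts the p^d-cycle.
module Submission where

open import Defs
open import Algebra.Bundles using (AbelianGroup; Semiring)
import Algebra.Construct.DirectProduct as DirectProduct
import Algebra.Construct.Subst.Equality as SubstEquality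
open import Algebra.Core using (Op₁; Op₂)
open import Algebra.Structures using (IsAbelianGroup)
open import Data.Fin.Base using (Fin; zero; suc; toℕ; fromℕ; fromℕ<; inject₁)
import Data.Fin.Permutation as Permutation
open Permutation using (_⟨$⟩ʳ_; _⟨$⟩ˡ_; _∘ₚ_) renaming (id to idₚ; flip to flipₚ)
open import Data.Fin.Properties
  using (pigeonhole; injective⇒≤; toℕ<n; toℕ-fromℕ; toℕ-fromℕ<; toℕ-inject₁)
open import Data.Nat.Base as ℕ
  using (ℕ; zero; suc; _∸_; _<_; _≤_; s≤s; z≤n; _!; pred; NonZero; >-nonZero; nonTrivial⇒n>1)
open import Data.Nat.Combinatorics using (_C_; nCn≡1; nCk≡n!/k![n-k]!; k![n∸k]!∣n!)
open import Data.Nat.Coprimality using (Coprime; coprime-Bézout; prime⇒coprime)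
open import Data.Nat.DivMod using (_%_; _/_; m/n*n≡m; m≡m%n+[m/n]*n; m%n<n; m<n*o⇒m/o<n)
open import Data.Nat.Divisibility using (_∣_; _∤_; divides; m∣m*n; ∣⇒≤; ∣1⇒≡1)
open import Data.Nat.GCD using (module Bézout)
open import Data.Nat.GeneralisedArithmetic using (iterate)
open import Data.Nat.Primality
  using (Prime; euclidsLemma; ¬prime[0]; ¬prime[1]; prime⇒nonZero; prime⇒nonTrivial)
import Data.Nat.Properties as ℕₚ
open ℕₚ
  using (_≟_; <-cmp; ≤-trans; ≤-<-trans; <⇒≤; <⇒≢; <⇒≱; ≤⇒≯; n<1+n; n≤1+n; <⇒≤pred; suc-pred;
         m∸n≤m; n∸n≡0; m+[n∸m]≡n; m∸n+n≡m; m<n⇒0<n∸m; ^-monoʳ-<; m^n>0; m^n≢0; _!*_!≢0)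
open import Data.Product.Base using (Σ; _×_; _,_; proj₁; proj₂; ∃-syntax)
open import Data.Product.Relation.Binary.Pointwise.NonDependent using (≡×≡⇒≡; ≡⇒≡×≡)
open import Data.Sum.Base using (inj₁; inj₂)
open import Function.Base using (id; const)
open import Function.Definitions using (Injective)
open import Level using (Level; 0ℓ)
open import Relation.Binary.Definitions using (tri<; tri≈; tri>)
open import Relation.Binary.PropositionalEquality
  using (_≡_; _≢_; refl; sym; trans; cong; cong₂; subst; isEquivalence; module ≡-Reasoning)
open import Relation.Nullary using (¬_)
open import Relation.Nullary.Decidable using (yes; no)
open import Relation.Nullary.Negation using (contradiction)

prime⇒1<p : ∀ {p} → Prime p → 1 < p
prime⇒1<p {p} p-prime = nonTrivial⇒n>1 p {{prime⇒nonTrivial p-prime}}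

prime∤m! : ∀ {p m} → Prime p → m < p → p ∤ m !
prime∤m! {m = zero}  p-prime _   p∣1 = ¬prime[1] (subst Prime (∣1⇒≡1 p∣1) p-prime)
prime∤m! {m = suc m} p-prime m<p p∣m! with euclidsLemma (suc m) (m !) p-prime p∣m!
... | inj₁ p∣1+m = ≤⇒≯ (∣⇒≤ p∣1+m) m<p
... | inj₂ p∣m!  = prime∤m! p-prime (<⇒≤ m<p) p∣m!

prime∣pCk : ∀ {p k} → Prime p → 0 < k → k < p → p ∣ p C k
prime∣pCk {p@(suc p-1)} {k@(suc k-1)} p-prime 0<k k<p
  with euclidsLemma (p C k) (k ! ℕ.* (p ∸ k) !) p-prime p∣pCk*k!*[p-k]!
  where
  instance _ = k !* (p ∸ k) !≢0
  p∣pCk*k!*[p-k]! : p ∣ (p C k) ℕ.* (k ! ℕ.* (p ∸ k) !)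
  p∣pCk*k!*[p-k]! = subst (p ∣_) (sym pCk*k!*[p-k]!≡p!) (m∣m*n (p-1 !))
    where
    pCk*k!*[p-k]!≡p! : (p C k) ℕ.* (k ! ℕ.* (p ∸ k) !) ≡ p !
    pCk*k!*[p-k]!≡p! = trans (cong (ℕ._* (k ! ℕ.* (p ∸ k) !)) (nCk≡n!/k![n-k]! (<⇒≤ k<p)))
                             (m/n*n≡m (k![n∸k]!∣n! (<⇒≤ k<p)))
... | inj₁ p∣pCk = p∣pCk
... | inj₂ p∣k!*[p-k]! with euclidsLemma (k !) ((p ∸ k) !) p-prime p∣k!*[p-k]!
...   | inj₁ p∣k!     = contradiction p∣k! (prime∤m! p-prime k<p)
...   | inj₂ p∣[p-k]! = contradiction p∣[p-k]! (prime∤m! p-prime (s≤s (m∸n≤m p-1 k-1)))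

1+e<m^e-step : ∀ {m e} → 1 < m → suc e < m ℕ.^ e → suc (suc e) < m ℕ.^ suc e
1+e<m^e-step {m} {e} 1<m 1+e<m^e = ≤-trans (s≤s 1+e<m^e) (^-monoʳ-< m 1<m (n<1+n e))

1+e<p^e : ∀ {p e} → Prime p → 1 ≤ e → ¬ (p ≡ 2 × suc e ≡ 2) → suc e < p ℕ.^ e
1+e<p^e {0}                 p-prime = contradiction p-prime ¬prime[0]
1+e<p^e {1}                 p-prime = contradiction p-prime ¬prime[1]
1+e<p^e {2} {1}             _ _ ¬[2≡2×2≡2] = contradiction (refl , refl) ¬[2≡2×2≡2]
1+e<p^e {2} {2}             _ _ _ = ℕₚ.≤-refl
1+e<p^e {2} {suc e@(suc (suc _))} p-prime _ _ =
  1+e<m^e-step (prime⇒1<p p-prime) (1+e<p^e p-prime (s≤s z≤n) λ { (_ , ()) })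
1+e<p^e {suc (suc (suc _))} {1} _ _ _ = s≤s (s≤s (s≤s z≤n))
1+e<p^e {suc (suc (suc _))} {suc e@(suc _)} p-prime _ _ =
  1+e<m^e-step (prime⇒1<p p-prime) (1+e<p^e p-prime (s≤s z≤n) λ { (() , _) })

module Frobenius {a ℓ : Level} (S : Semiring a ℓ) where

  open Semiring S hiding (zero; refl; sym; trans)
  open Semiring S using () renaming (refl to ≈-refl; sym to ≈-sym; trans to ≈-trans)
  open import Algebra.Properties.Semiring.Exp S using (_^_; ^-assocʳ; ^-congˡ)
  open import Algebra.Properties.Semiring.Mult S
    using (×-assocˡ; ×-assoc-*; ×-congʳ) renaming (_×_ to _·_)
  open import Algebra.Properties.Monoid.Sum +-monoid
    using (sum; sum-init-last; sum-cong-≋; sum-replicate-zero)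
  import Algebra.Properties.Semiring.Binomial S as Binomial
  open import Relation.Binary.Reasoning.Setoid setoid

  ∣⇒·≈0 : ∀ {p m} → p · 1# ≈ 0# → p ∣ m → ∀ x → m · x ≈ 0#
  ∣⇒·≈0 {p} p·1≈0 (divides q refl) x = begin
    (q ℕ.* p) · x      ≡⟨ cong (_· x) (ℕₚ.*-comm q p) ⟩
    (p ℕ.* q) · x      ≈⟨ ×-assocˡ x p q ⟨
    p · (q · x)        ≈⟨ ×-congʳ p (*-identityˡ (q · x)) ⟨
    p · (1# * q · x)   ≈⟨ ×-assoc-* p 1# (q · x) ⟨
    (p · 1#) * (q · x) ≈⟨ *-congʳ p·1≈0 ⟩
    0# * (q · x)       ≈⟨ zeroˡ (q · x) ⟩
    0#                 ∎

  frobenius : ∀ {p} → Prime p → p · 1# ≈ 0# → ∀ {x y} → x * y ≈ y * x → (x + y) ^ p ≈ x ^ p + y ^ p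
  frobenius {zero}        p-prime = contradiction p-prime ¬prime[0]
  frobenius {p@(suc p-1)} p-prime p·1≈0 {x} {y} x*y≈y*x = begin
    (x + y) ^ p                               ≈⟨ theorem x*y≈y*x p ⟩
    term zero + sum (λ i → term (suc i))      ≈⟨ +-congˡ (sum-init-last (λ i → term (suc i))) ⟩
    term zero + (sum middle + term (fromℕ p)) ≈⟨ +-cong first≈y^p (+-cong middle≈0 last≈x^p) ⟩
    y ^ p + (0# + x ^ p)                      ≈⟨ +-congˡ (+-identityˡ (x ^ p)) ⟩
    y ^ p + x ^ p                             ≈⟨ +-comm (y ^ p) (x ^ p) ⟩
    x ^ p + y ^ p                             ∎
    where
    open Binomial x y using (theorem; binomialTerm)
    term : Fin (suc p) → Carrier
    term = binomialTerm p
    middle : Fin p-1 → Carrier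
    middle i = term (suc (inject₁ i))
    first≈y^p : term zero ≈ y ^ p
    first≈y^p = ≈-trans (+-identityʳ (1# * y ^ p)) (*-identityˡ (y ^ p))
    last≈x^p : term (fromℕ p) ≈ x ^ p
    last≈x^p rewrite toℕ-fromℕ p-1 | nCn≡1 p | n∸n≡0 p-1 =
      ≈-trans (+-identityʳ (x ^ p * 1#)) (*-identityʳ (x ^ p))
    middle≈0 : sum middle ≈ 0#
    middle≈0 = ≈-trans (sum-cong-≋ (λ i → ∣⇒·≈0 p·1≈0 (p∣pCk i) _)) (sum-replicate-zero p-1)
      where
      p∣pCk : ∀ i → p ∣ p C toℕ (suc (inject₁ i))
      p∣pCk i = prime∣pCk p-prime (s≤s z≤n) (s≤s (subst (_< p-1) (sym (toℕ-inject₁ i)) (toℕ<n i)))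

  1#^n≈1# : ∀ n → 1# ^ n ≈ 1#
  1#^n≈1# zero    = ≈-refl
  1#^n≈1# (suc n) = ≈-trans (*-identityˡ (1# ^ n)) (1#^n≈1# n)

  frobenius-^ : ∀ {p} → Prime p → p · 1# ≈ 0# → ∀ e x → (x + 1#) ^ (p ℕ.^ e) ≈ x ^ (p ℕ.^ e) + 1#
  frobenius-^ p-prime p·1≈0 zero x = ≈-trans (*-identityʳ (x + 1#)) (+-congʳ (≈-sym (*-identityʳ x)))
  frobenius-^ {p} p-prime p·1≈0 (suc e) x = begin
    (x + 1#) ^ (p ℕ.* q) ≈⟨ ^-assocʳ (x + 1#) p q ⟨
    ((x + 1#) ^ p) ^ q   ≈⟨ ^-congˡ q (frobenius p-prime p·1≈0 x*1≈1*x) ⟩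
    (x ^ p + 1# ^ p) ^ q ≈⟨ ^-congˡ q (+-congˡ (1#^n≈1# p)) ⟩
    (x ^ p + 1#) ^ q     ≈⟨ frobenius-^ p-prime p·1≈0 e (x ^ p) ⟩
    (x ^ p) ^ q + 1#     ≈⟨ +-congʳ (^-assocʳ x p q) ⟩
    x ^ (p ℕ.* q) + 1#   ∎
    where
    q = p ℕ.^ e
    x*1≈1*x : x * 1# ≈ 1# * x
    x*1≈1*x = ≈-trans (*-identityʳ x) (≈-sym (*-identityˡ x))

module Endomorphisms
  {A : Set} {_∙_ : Op₂ A} {ε : A} {_⁻¹ : Op₁ A} (isAbelianGroup : IsAbelianGroup _≡_ _∙_ ε _⁻¹) where

  abelianGroup : AbelianGroup 0ℓ 0ℓ
  abelianGroup = record { isAbelianGroup = isAbelianGroup }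

  open AbelianGroup abelianGroup public
    using (assoc; comm; identityˡ; identityʳ; inverseˡ; commutativeMonoid; group)
    renaming (_∙_ to infixl 6 _+_; ε to 0#; _⁻¹ to infix 8 -_)
  open import Algebra.Properties.Group group public using (∙-cancelˡ; ∙-cancelʳ)
  open import Algebra.Properties.AbelianGroup abelianGroup using (⁻¹-∙-comm)
  open import Algebra.Properties.CommutativeSemigroup (AbelianGroup.commutativeSemigroup abelianGroup)
    public using (interchange)
  open import Algebra.Properties.CommutativeMonoid.Mult commutativeMonoid public
    using (×-homo-+; ×-assocˡ) renaming (_×_ to _·_)

  ·-zeroʳ : ∀ n → n · 0# ≡ 0#
  ·-zeroʳ zero    = refl
  ·-zeroʳ (suc n) = trans (identityˡ (n · 0#)) (·-zeroʳ n)

  record Endomorphism : Set where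
    constructor endomorphism
    infixr 6.5 _⟨$⟩_
    field
      _⟨$⟩_ : A → A
      homo  : ∀ x y → _⟨$⟩_ (x + y) ≡ _⟨$⟩_ x + _⟨$⟩_ y

  open Endomorphism public

  ⟨$⟩-zero : ∀ F → F ⟨$⟩ 0# ≡ 0#
  ⟨$⟩-zero F = ∙-cancelˡ (F ⟨$⟩ 0#) (F ⟨$⟩ 0#) 0# (begin
    F ⟨$⟩ 0# + F ⟨$⟩ 0#   ≡⟨ homo F 0# 0# ⟨
    F ⟨$⟩ (0# + 0#)       ≡⟨ cong (F ⟨$⟩_) (identityʳ 0#) ⟩
    F ⟨$⟩ 0#              ≡⟨ identityʳ (F ⟨$⟩ 0#) ⟨
    F ⟨$⟩ 0# + 0#         ∎)
    where open ≡-Reasoning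

  ⟨$⟩-· : ∀ F n x → F ⟨$⟩ (n · x) ≡ n · (F ⟨$⟩ x)
  ⟨$⟩-· F zero    x = ⟨$⟩-zero F
  ⟨$⟩-· F (suc n) x = trans (homo F x (n · x)) (cong (F ⟨$⟩ x +_) (⟨$⟩-· F n x))

  infix  4 _≈ᴱ_
  infixl 6 _+ᴱ_
  infixl 7 _*ᴱ_

  _≈ᴱ_ : Endomorphism → Endomorphism → Set
  F ≈ᴱ G = ∀ x → F ⟨$⟩ x ≡ G ⟨$⟩ x

  0ᴱ 1ᴱ : Endomorphism
  0ᴱ = endomorphism (const 0#) (λ _ _ → sym (identityˡ 0#))
  1ᴱ = endomorphism id (λ _ _ → refl)

  -- Composition is diagrammatic, as for _∘ₚ_ (F *ᴱ G applies F first), so that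
  -- F ^ᴱ suc k ⟨$⟩ x reduces to F ^ᴱ k ⟨$⟩ (F ⟨$⟩ x), matching iterate and _^ₚ_.
  _+ᴱ_ _*ᴱ_ : Endomorphism → Endomorphism → Endomorphism
  F +ᴱ G = endomorphism (λ x → F ⟨$⟩ x + G ⟨$⟩ x) λ x y →
    trans (cong₂ _+_ (homo F x y) (homo G x y)) (interchange _ _ _ _)
  F *ᴱ G = endomorphism (λ x → G ⟨$⟩ (F ⟨$⟩ x)) λ x y →
    trans (cong (G ⟨$⟩_) (homo F x y)) (homo G _ _)

  -ᴱ_ : Endomorphism → Endomorphism
  -ᴱ F = endomorphism (λ x → - (F ⟨$⟩ x)) λ x y →
    trans (cong -_ (homo F x y)) (sym (⁻¹-∙-comm _ _))

  endomorphismSemiring : Semiring 0ℓ 0ℓ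
  endomorphismSemiring = record
    { Carrier = Endomorphism
    ; _≈_ = _≈ᴱ_
    ; _+_ = _+ᴱ_
    ; _*_ = _*ᴱ_
    ; 0# = 0ᴱ
    ; 1# = 1ᴱ
    ; isSemiring = record
      { isSemiringWithoutAnnihilatingZero = record
        { +-isCommutativeMonoid = record
          { isMonoid = record
            { isSemigroup = record
              { isMagma = record
                { isEquivalence = record
                  { refl  = λ _ → refl
                  ; sym   = λ F≈G x → sym (F≈G x)
                  ; trans = λ F≈G G≈H x → trans (F≈G x) (G≈H x)
                  }
                ; ∙-cong = λ F≈F′ G≈G′ x → cong₂ _+_ (F≈F′ x) (G≈G′ x)
                }
              ; assoc = λ F G H x → assoc (F ⟨$⟩ x) (G ⟨$⟩ x) (H ⟨$⟩ x)
              }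
            ; identity = (λ F x → identityˡ (F ⟨$⟩ x)) , (λ F x → identityʳ (F ⟨$⟩ x))
            }
          ; comm = λ F G x → comm (F ⟨$⟩ x) (G ⟨$⟩ x)
          }
        ; *-cong = λ {F} {F′} {G} F≈F′ G≈G′ x → trans (cong (G ⟨$⟩_) (F≈F′ x)) (G≈G′ (F′ ⟨$⟩ x))
        ; *-assoc = λ _ _ _ _ → refl
        ; *-identity = (λ _ _ → refl) , (λ _ _ → refl)
        ; distrib = (λ _ _ _ _ → refl) , (λ F G H x → homo F (G ⟨$⟩ x) (H ⟨$⟩ x))
        }
      ; zero = (λ F _ → ⟨$⟩-zero F) , (λ _ _ → refl)
      }
    }

  open import Algebra.Properties.Semiring.Exp endomorphismSemiring public
    using () renaming (_^_ to _^ᴱ_; ^-congˡ to ^ᴱ-congˡ)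
  open import Algebra.Properties.Semiring.Mult endomorphismSemiring public
    using () renaming (_×_ to _·ᴱ_)

  ·ᴱ-⟨$⟩ : ∀ n F x → (n ·ᴱ F) ⟨$⟩ x ≡ n · (F ⟨$⟩ x)
  ·ᴱ-⟨$⟩ zero    F x = refl
  ·ᴱ-⟨$⟩ (suc n) F x = cong (F ⟨$⟩ x +_) (·ᴱ-⟨$⟩ n F x)

  ·ᴱ1ᴱ-central : ∀ n F → (n ·ᴱ 1ᴱ) *ᴱ F ≈ᴱ F *ᴱ (n ·ᴱ 1ᴱ)
  ·ᴱ1ᴱ-central n F z =
    trans (cong (F ⟨$⟩_) (·ᴱ-⟨$⟩ n 1ᴱ z)) (trans (⟨$⟩-· F n z) (sym (·ᴱ-⟨$⟩ n 1ᴱ (F ⟨$⟩ z))))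

  ^ᴱ-+ : ∀ D m n x → D ^ᴱ (m ℕ.+ n) ⟨$⟩ x ≡ D ^ᴱ n ⟨$⟩ (D ^ᴱ m ⟨$⟩ x)
  ^ᴱ-+ D zero    n x = refl
  ^ᴱ-+ D (suc m) n x = ^ᴱ-+ D m n (D ⟨$⟩ x)

  ^ᴱ≈0-mono : ∀ {D m n} → D ^ᴱ m ≈ᴱ 0ᴱ → m ≤ n → D ^ᴱ n ≈ᴱ 0ᴱ
  ^ᴱ≈0-mono {D} {m} {n} D^m≈0 m≤n x = begin
    D ^ᴱ n ⟨$⟩ x                    ≡⟨ cong (λ k → D ^ᴱ k ⟨$⟩ x) (m+[n∸m]≡n m≤n) ⟨
    D ^ᴱ (m ℕ.+ (n ∸ m)) ⟨$⟩ x       ≡⟨ ^ᴱ-+ D m (n ∸ m) x ⟩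
    D ^ᴱ (n ∸ m) ⟨$⟩ (D ^ᴱ m ⟨$⟩ x)  ≡⟨ cong (D ^ᴱ (n ∸ m) ⟨$⟩_) (D^m≈0 x) ⟩
    D ^ᴱ (n ∸ m) ⟨$⟩ 0#             ≡⟨ ⟨$⟩-zero (D ^ᴱ (n ∸ m)) ⟩
    0#                              ∎
    where open ≡-Reasoning

  ^ᴱ-comm : ∀ D R → R *ᴱ D ≈ᴱ D *ᴱ R → ∀ k → R *ᴱ D ^ᴱ k ≈ᴱ D ^ᴱ k *ᴱ R
  ^ᴱ-comm D R R*D≈D*R zero    z = refl
  ^ᴱ-comm D R R*D≈D*R (suc k) z =
    trans (cong (D ^ᴱ k ⟨$⟩_) (R*D≈D*R z)) (^ᴱ-comm D R R*D≈D*R k (D ⟨$⟩ z))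

  module _ {p : ℕ} (p-prime : Prime p) (p·x≡0 : ∀ x → p · x ≡ 0#) where

    private instance
      p≢0 : NonZero p
      p≢0 = prime⇒nonZero p-prime

    q*n·x≡0 : ∀ q {n x} → n · x ≡ 0# → (q ℕ.* n) · x ≡ 0#
    q*n·x≡0 q {n} {x} n·x≡0 = trans (sym (×-assocˡ x q n)) (trans (cong (q ·_) n·x≡0) (·-zeroʳ q))

    coprime-·≡0⇒≡0 : ∀ {w x} → Coprime p w → w · x ≡ 0# → x ≡ 0#
    coprime-·≡0⇒≡0 {w} {x} p⊥w w·x≡0 with coprime-Bézout p⊥w
    ... | Bézout.+- a b 1+bw≡ap = begin
      x                  ≡⟨ identityʳ x ⟨
      x + 0#             ≡⟨ cong (x +_) (q*n·x≡0 b w·x≡0) ⟨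
      suc (b ℕ.* w) · x  ≡⟨ cong (_· x) 1+bw≡ap ⟩
      (a ℕ.* p) · x      ≡⟨ q*n·x≡0 a (p·x≡0 x) ⟩
      0#                 ∎
      where open ≡-Reasoning
    ... | Bézout.-+ a b 1+ap≡bw = begin
      x                  ≡⟨ identityʳ x ⟨
      x + 0#             ≡⟨ cong (x +_) (q*n·x≡0 a (p·x≡0 x)) ⟨
      suc (a ℕ.* p) · x  ≡⟨ cong (_· x) 1+ap≡bw ⟩
      (b ℕ.* w) · x      ≡⟨ q*n·x≡0 b w·x≡0 ⟩
      0#                 ∎
      where open ≡-Reasoning

    ·-cancel-< : ∀ {u v x} → u < v → v < p → u · x ≡ v · x → x ≡ 0#
    ·-cancel-< {u} {v} {x} u<v v<p u·x≡v·x = coprime-·≡0⇒≡0 p⊥v-u [v-u]·x≡0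
      where
      open ≡-Reasoning
      p⊥v-u : Coprime p (v ∸ u)
      p⊥v-u = prime⇒coprime p-prime {{>-nonZero (m<n⇒0<n∸m u<v)}} (≤-<-trans (m∸n≤m v u) v<p)
      [v-u]·x≡0 : (v ∸ u) · x ≡ 0#
      [v-u]·x≡0 = ∙-cancelˡ (u · x) ((v ∸ u) · x) 0# (begin
        u · x + (v ∸ u) · x   ≡⟨ ×-homo-+ x u (v ∸ u) ⟨
        (u ℕ.+ (v ∸ u)) · x   ≡⟨ cong (_· x) (m+[n∸m]≡n (<⇒≤ u<v)) ⟩
        v · x                 ≡⟨ u·x≡v·x ⟨
        u · x                 ≡⟨ identityʳ (u · x) ⟨
        u · x + 0#            ∎)

    ·-cancel : ∀ {u v x} → u < p → v < p → u ≢ v → u · x ≡ v · x → x ≡ 0#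
    ·-cancel {u} {v} u<p v<p u≢v u·x≡v·x with <-cmp u v
    ... | tri< u<v _ _ = ·-cancel-< u<v v<p u·x≡v·x
    ... | tri≈ _ u≡v _ = contradiction u≡v u≢v
    ... | tri> _ _ v<u = ·-cancel-< v<u u<p (sym u·x≡v·x)

    p·1ᴱ≈0ᴱ : p ·ᴱ 1ᴱ ≈ᴱ 0ᴱ
    p·1ᴱ≈0ᴱ x = trans (·ᴱ-⟨$⟩ p 1ᴱ x) (p·x≡0 x)

    frobeniusᴱ : ∀ e F → (F +ᴱ 1ᴱ) ^ᴱ (p ℕ.^ e) ≈ᴱ F ^ᴱ (p ℕ.^ e) +ᴱ 1ᴱ
    frobeniusᴱ = Frobenius.frobenius-^ endomorphismSemiring p-prime p·1ᴱ≈0ᴱ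

    module _ (D : Endomorphism) where

      -- digitPolynomial L i = ∑_{k ≤ L} (k-th base-p digit of i) · D^k.
      digitPolynomial : ℕ → ℕ → Endomorphism
      digitPolynomial zero    i = i ·ᴱ 1ᴱ
      digitPolynomial (suc L) i = (i % p) ·ᴱ 1ᴱ +ᴱ D *ᴱ digitPolynomial L (i / p)

      digitPolynomial-comm : ∀ L i → digitPolynomial L i *ᴱ D ≈ᴱ D *ᴱ digitPolynomial L i
      digitPolynomial-comm zero    i z = ·ᴱ1ᴱ-central i D z
      digitPolynomial-comm (suc L) i z = trans (homo D _ _)
        (cong₂ _+_ (·ᴱ1ᴱ-central (i % p) D z) (digitPolynomial-comm L (i / p) (D ⟨$⟩ z)))

      module _ {m : ℕ} (D^m≈0 : D ^ᴱ m ≈ᴱ 0ᴱ) where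

        unit+nilpotent-injective : ∀ {u v} P Q {x} → u < p → v < p → u ≢ v →
          P *ᴱ D ≈ᴱ D *ᴱ P → Q *ᴱ D ≈ᴱ D *ᴱ Q →
          (u ·ᴱ 1ᴱ +ᴱ D *ᴱ P) ⟨$⟩ x ≡ (v ·ᴱ 1ᴱ +ᴱ D *ᴱ Q) ⟨$⟩ x → x ≡ 0#
        unit+nilpotent-injective {u} {v} P Q {x} u<p v<p u≢v P-comm Q-comm eq = descend m (D^m≈0 x)
          where
          descend : ∀ k → D ^ᴱ k ⟨$⟩ x ≡ 0# → x ≡ 0#
          descend zero    x≡0        = x≡0
          descend (suc k) D^[1+k]x≡0 = descend k (·-cancel u<p v<p u≢v (begin
            u · (D ^ᴱ k ⟨$⟩ x)                      ≡⟨ leading-term u P P-comm ⟨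
            D ^ᴱ k ⟨$⟩ ((u ·ᴱ 1ᴱ +ᴱ D *ᴱ P) ⟨$⟩ x)  ≡⟨ cong (D ^ᴱ k ⟨$⟩_) eq ⟩
            D ^ᴱ k ⟨$⟩ ((v ·ᴱ 1ᴱ +ᴱ D *ᴱ Q) ⟨$⟩ x)  ≡⟨ leading-term v Q Q-comm ⟩
            v · (D ^ᴱ k ⟨$⟩ x)                      ∎))
            where
            open ≡-Reasoning
            leading-term : ∀ w R → R *ᴱ D ≈ᴱ D *ᴱ R →
                           D ^ᴱ k ⟨$⟩ ((w ·ᴱ 1ᴱ +ᴱ D *ᴱ R) ⟨$⟩ x) ≡ w · (D ^ᴱ k ⟨$⟩ x)
            leading-term w R R-comm = begin
              D ^ᴱ k ⟨$⟩ ((w ·ᴱ 1ᴱ) ⟨$⟩ x + R ⟨$⟩ (D ⟨$⟩ x))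
                ≡⟨ homo (D ^ᴱ k) _ _ ⟩
              D ^ᴱ k ⟨$⟩ ((w ·ᴱ 1ᴱ) ⟨$⟩ x) + D ^ᴱ k ⟨$⟩ (R ⟨$⟩ (D ⟨$⟩ x))
                ≡⟨ cong₂ _+_ (trans (cong (D ^ᴱ k ⟨$⟩_) (·ᴱ-⟨$⟩ w 1ᴱ x)) (⟨$⟩-· (D ^ᴱ k) w x))
                             (^ᴱ-comm D R R-comm k (D ⟨$⟩ x)) ⟩
              w · (D ^ᴱ k ⟨$⟩ x) + R ⟨$⟩ (D ^ᴱ suc k ⟨$⟩ x)
                ≡⟨ cong (λ y → w · (D ^ᴱ k ⟨$⟩ x) + R ⟨$⟩ y) D^[1+k]x≡0 ⟩
              w · (D ^ᴱ k ⟨$⟩ x) + R ⟨$⟩ 0#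
                ≡⟨ trans (cong (w · (D ^ᴱ k ⟨$⟩ x) +_) (⟨$⟩-zero R)) (identityʳ _) ⟩
              w · (D ^ᴱ k ⟨$⟩ x) ∎

        digitPolynomial-collision : ∀ L {i j x} → i < p ℕ.^ suc L → j < p ℕ.^ suc L → i ≢ j →
          digitPolynomial L i ⟨$⟩ x ≡ digitPolynomial L j ⟨$⟩ x → D ^ᴱ L ⟨$⟩ x ≡ 0#
        digitPolynomial-collision zero {i} {j} {x} i<p j<p i≢j eq =
          ·-cancel (subst (i <_) (ℕₚ.*-identityʳ p) i<p) (subst (j <_) (ℕₚ.*-identityʳ p) j<p) i≢j
                   (trans (sym (·ᴱ-⟨$⟩ i 1ᴱ x)) (trans eq (·ᴱ-⟨$⟩ j 1ᴱ x)))
        digitPolynomial-collision (suc L) {i} {j} {x} i< j< i≢j eq with i % p ≟ j % p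
        ... | yes i%p≡j%p =
          digitPolynomial-collision L (quotient< i<) (quotient< j<) i/p≢j/p
            (∙-cancelˡ _ _ _ (trans eq (cong (λ c → (c ·ᴱ 1ᴱ) ⟨$⟩ x + _) (sym i%p≡j%p))))
          where
          quotient< : ∀ {k} → k < p ℕ.^ suc (suc L) → k / p < p ℕ.^ suc L
          quotient< {k} k< = m<n*o⇒m/o<n (subst (k <_) (ℕₚ.*-comm p _) k<)
          i/p≢j/p : i / p ≢ j / p
          i/p≢j/p i/p≡j/p = i≢j (begin
            i                        ≡⟨ m≡m%n+[m/n]*n i p ⟩
            i % p ℕ.+ i / p ℕ.* p    ≡⟨ cong₂ (λ r q → r ℕ.+ q ℕ.* p) i%p≡j%p i/p≡j/p ⟩
            j % p ℕ.+ j / p ℕ.* p    ≡⟨ m≡m%n+[m/n]*n j p ⟨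
            j                        ∎)
            where open ≡-Reasoning
        ... | no i%p≢j%p = trans (cong (D ^ᴱ suc L ⟨$⟩_) x≡0) (⟨$⟩-zero (D ^ᴱ suc L))
          where
          x≡0 : x ≡ 0#
          x≡0 = unit+nilpotent-injective (digitPolynomial L (i / p)) (digitPolynomial L (j / p))
                  (m%n<n i p) (m%n<n j p) i%p≢j%p
                  (digitPolynomial-comm L (i / p)) (digitPolynomial-comm L (j / p)) eq

        -- Two of the p^(d+1) combinations ∑_{k ≤ d} c_k · D^k x (c_k < p) coincide. At the first
        -- differing coefficient k, a unit plus a nilpotent kills D^k x, so D^k x = 0 and D^d x = 0.
        nilpotent⇒^dim≈0 : ∀ {d} {ι : A → Fin (p ℕ.^ d)} → Injective _≡_ _≡_ ι → D ^ᴱ d ≈ᴱ 0ᴱ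
        nilpotent⇒^dim≈0 {d} {ι} ι-injective x
          with k , l , k<l , ιk≡ιl ← pigeonhole (^-monoʳ-< p (prime⇒1<p p-prime) (n<1+n d))
                                                (λ k → ι (digitPolynomial d (toℕ k) ⟨$⟩ x))
          = digitPolynomial-collision d (toℕ<n k) (toℕ<n l) (<⇒≢ k<l) (ι-injective ιk≡ιl)

module AffineMaps
  {A : Set} {_∙_ : Op₂ A} {ε : A} {_⁻¹ : Op₁ A} (isAbelianGroup : IsAbelianGroup _≡_ _∙_ ε _⁻¹) where

  open Endomorphisms isAbelianGroup

  ×-isAbelianGroup : IsAbelianGroup _≡_ _ _ _
  ×-isAbelianGroup = SubstEquality.isAbelianGroup (≡×≡⇒≡ , ≡⇒≡×≡)
    (AbelianGroup.isAbelianGroup (DirectProduct.abelianGroup abelianGroup abelianGroup))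

  module V = Endomorphisms ×-isAbelianGroup

  V·-⟨,⟩ : ∀ n x y → n V.· (x , y) ≡ (n · x , n · y)
  V·-⟨,⟩ zero    x y = refl
  V·-⟨,⟩ (suc n) x y = cong ((x , y) V.+_) (V·-⟨,⟩ n x y)

  triangular : Endomorphism → Endomorphism → Endomorphism → V.Endomorphism
  triangular F G H = V.endomorphism (λ (x , y) → (F ⟨$⟩ x + G ⟨$⟩ y , H ⟨$⟩ y)) λ (x , y) (x′ , y′) →
    cong₂ _,_ (trans (cong₂ _+_ (homo F x x′) (homo G y y′)) (interchange _ _ _ _)) (homo H y y′)

  module _ {p : ℕ} (p-prime : Prime p) (p·x≡0 : ∀ x → p · x ≡ 0#)
           (σ b : A → A) (σ-affine : ∀ x y → σ (x + y) ≡ b x + σ y) where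

    σ≡b+σ0 : ∀ x → σ x ≡ b x + σ 0#
    σ≡b+σ0 x = trans (cong σ (sym (identityʳ x))) (σ-affine x 0#)

    linear : Endomorphism
    linear = endomorphism b λ x y → ∙-cancelʳ (σ 0#) (b (x + y)) (b x + b y) (begin
      b (x + y) + σ 0#    ≡⟨ σ≡b+σ0 (x + y) ⟨
      σ (x + y)           ≡⟨ σ-affine x y ⟩
      b x + σ y           ≡⟨ cong (b x +_) (σ≡b+σ0 y) ⟩
      b x + (b y + σ 0#)  ≡⟨ assoc (b x) (b y) (σ 0#) ⟨
      b x + b y + σ 0#    ∎)
      where open ≡-Reasoning

    δ : Endomorphism
    δ = linear +ᴱ -ᴱ 1ᴱ

    M E : V.Endomorphism
    M = triangular linear 1ᴱ 1ᴱ
    E = triangular δ 1ᴱ 0ᴱ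

    M≈E+1 : M V.≈ᴱ E V.+ᴱ V.1ᴱ
    M≈E+1 (x , y) = cong₂ _,_ (sym (begin
      b x + - x + y + x      ≡⟨ assoc (b x + - x) y x ⟩
      b x + - x + (y + x)    ≡⟨ cong (b x + - x +_) (comm y x) ⟩
      b x + - x + (x + y)    ≡⟨ assoc (b x) (- x) (x + y) ⟩
      b x + (- x + (x + y))  ≡⟨ cong (b x +_) (assoc (- x) x y) ⟨
      b x + (- x + x + y)    ≡⟨ cong (λ z → b x + (z + y)) (inverseˡ x) ⟩
      b x + (0# + y)         ≡⟨ cong (b x +_) (identityˡ y) ⟩
      b x + y                ∎)) (sym (identityˡ y))
      where open ≡-Reasoning

    M^k-⟨$⟩ : ∀ k x → M V.^ᴱ k V.⟨$⟩ (x , σ 0#) ≡ (iterate σ x k , σ 0#)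
    M^k-⟨$⟩ zero    x = refl
    M^k-⟨$⟩ (suc k) x =
      trans (cong (λ z → M V.^ᴱ k V.⟨$⟩ (z , σ 0#)) (sym (σ≡b+σ0 x))) (M^k-⟨$⟩ k (σ x))

    E^[1+k]-⟨$⟩ : ∀ k x y → E V.^ᴱ suc k V.⟨$⟩ (x , y) ≡ (δ ^ᴱ suc k ⟨$⟩ x + δ ^ᴱ k ⟨$⟩ y , 0#)
    E^[1+k]-⟨$⟩ zero    x y = refl
    E^[1+k]-⟨$⟩ (suc k) x y = trans (E^[1+k]-⟨$⟩ k (δ ⟨$⟩ x + y) 0#) (cong (_, 0#) (begin
      δ ^ᴱ suc k ⟨$⟩ (δ ⟨$⟩ x + y) + δ ^ᴱ k ⟨$⟩ 0#
        ≡⟨ cong (δ ^ᴱ suc k ⟨$⟩ (δ ⟨$⟩ x + y) +_) (⟨$⟩-zero (δ ^ᴱ k)) ⟩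
      δ ^ᴱ suc k ⟨$⟩ (δ ⟨$⟩ x + y) + 0#
        ≡⟨ identityʳ _ ⟩
      δ ^ᴱ suc k ⟨$⟩ (δ ⟨$⟩ x + y)
        ≡⟨ homo (δ ^ᴱ suc k) (δ ⟨$⟩ x) y ⟩
      δ ^ᴱ suc (suc k) ⟨$⟩ x + δ ^ᴱ suc k ⟨$⟩ y ∎))
      where open ≡-Reasoning

    iterate-frobenius : ∀ e k → suc k ≡ p ℕ.^ e → ∀ x →
                        iterate σ x (suc k) ≡ δ ^ᴱ suc k ⟨$⟩ x + δ ^ᴱ k ⟨$⟩ σ 0# + x
    iterate-frobenius e k 1+k≡p^e x = cong proj₁ (begin
      (iterate σ x (suc k) , σ 0#)
        ≡⟨ M^k-⟨$⟩ (suc k) x ⟨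
      M V.^ᴱ suc k V.⟨$⟩ (x , σ 0#)
        ≡⟨ V.^ᴱ-congˡ (suc k) M≈E+1 (x , σ 0#) ⟩
      (E V.+ᴱ V.1ᴱ) V.^ᴱ suc k V.⟨$⟩ (x , σ 0#)
        ≡⟨ frobenius-E (x , σ 0#) ⟩
      E V.^ᴱ suc k V.⟨$⟩ (x , σ 0#) V.+ (x , σ 0#)
        ≡⟨ cong (V._+ (x , σ 0#)) (E^[1+k]-⟨$⟩ k x (σ 0#)) ⟩
      (δ ^ᴱ suc k ⟨$⟩ x + δ ^ᴱ k ⟨$⟩ σ 0# + x , 0# + σ 0#) ∎)
      where
      open ≡-Reasoning
      p·v≡0 : ∀ v → p V.· v ≡ V.0#
      p·v≡0 (x , y) = trans (V·-⟨,⟩ p x y) (cong₂ _,_ (p·x≡0 x) (p·x≡0 y))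
      frobenius-E : (E V.+ᴱ V.1ᴱ) V.^ᴱ suc k V.≈ᴱ E V.^ᴱ suc k V.+ᴱ V.1ᴱ
      frobenius-E = subst (λ q → (E V.+ᴱ V.1ᴱ) V.^ᴱ q V.≈ᴱ E V.^ᴱ q V.+ᴱ V.1ᴱ) (sym 1+k≡p^e)
                          (V.frobeniusᴱ p-prime p·v≡0 e E)

    suc-pred-p^ : ∀ n → suc (pred (p ℕ.^ n)) ≡ p ℕ.^ n
    suc-pred-p^ n = suc-pred (p ℕ.^ n) {{m^n≢0 p n {{prime⇒nonZero p-prime}}}}

    ^p^f≡id⇒δ^p^f≈0 : ∀ f → (∀ x → iterate σ x (p ℕ.^ f) ≡ x) → δ ^ᴱ p ℕ.^ f ≈ᴱ 0ᴱ
    ^p^f≡id⇒δ^p^f≈0 f σ^p^f≡id x = subst (λ q → δ ^ᴱ q ⟨$⟩ x ≡ 0#) (suc-pred-p^ f) (begin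
      δ ^ᴱ suc j ⟨$⟩ x                      ≡⟨ identityʳ _ ⟨
      δ ^ᴱ suc j ⟨$⟩ x + 0#                 ≡⟨ cong (δ ^ᴱ suc j ⟨$⟩ x +_) δ^j[σ0]≡0 ⟨
      δ ^ᴱ suc j ⟨$⟩ x + δ ^ᴱ j ⟨$⟩ σ 0#     ≡⟨ E^p^f≡0 x ⟩
      0#                                    ∎)
      where
      open ≡-Reasoning
      j = pred (p ℕ.^ f)
      E^p^f≡0 : ∀ x → δ ^ᴱ suc j ⟨$⟩ x + δ ^ᴱ j ⟨$⟩ σ 0# ≡ 0#
      E^p^f≡0 x = ∙-cancelʳ x _ 0# (begin
        δ ^ᴱ suc j ⟨$⟩ x + δ ^ᴱ j ⟨$⟩ σ 0# + x  ≡⟨ iterate-frobenius f j (suc-pred-p^ f) x ⟨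
        iterate σ x (suc j)                    ≡⟨ cong (iterate σ x) (suc-pred-p^ f) ⟩
        iterate σ x (p ℕ.^ f)                  ≡⟨ σ^p^f≡id x ⟩
        x                                      ≡⟨ identityˡ x ⟨
        0# + x                                 ∎)
      δ^j[σ0]≡0 : δ ^ᴱ j ⟨$⟩ σ 0# ≡ 0#
      δ^j[σ0]≡0 = begin
        δ ^ᴱ j ⟨$⟩ σ 0#                        ≡⟨ identityˡ _ ⟨
        0# + δ ^ᴱ j ⟨$⟩ σ 0#                   ≡⟨ cong (_+ δ ^ᴱ j ⟨$⟩ σ 0#) (⟨$⟩-zero (δ ^ᴱ suc j)) ⟨
        δ ^ᴱ suc j ⟨$⟩ 0# + δ ^ᴱ j ⟨$⟩ σ 0#     ≡⟨ E^p^f≡0 0# ⟩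
        0#                                     ∎

    δ^[p^e-1]≈0⇒^p^e≡id : ∀ e → δ ^ᴱ pred (p ℕ.^ e) ≈ᴱ 0ᴱ → ∀ x → iterate σ x (p ℕ.^ e) ≡ x
    δ^[p^e-1]≈0⇒^p^e≡id e δ^k≈0 x = begin
      iterate σ x (p ℕ.^ e)                  ≡⟨ cong (iterate σ x) (suc-pred-p^ e) ⟨
      iterate σ x (suc k)                    ≡⟨ iterate-frobenius e k (suc-pred-p^ e) x ⟩
      δ ^ᴱ suc k ⟨$⟩ x + δ ^ᴱ k ⟨$⟩ σ 0# + x  ≡⟨ cong₂ (λ u v → u + v + x) δ^[1+k]x≡0 (δ^k≈0 (σ 0#)) ⟩
      0# + 0# + x                            ≡⟨ trans (cong (_+ x) (identityˡ 0#)) (identityˡ x) ⟩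
      x                                      ∎
      where
      open ≡-Reasoning
      k = pred (p ℕ.^ e)
      δ^[1+k]x≡0 : δ ^ᴱ suc k ⟨$⟩ x ≡ 0#
      δ^[1+k]x≡0 = ^ᴱ≈0-mono δ^k≈0 (n≤1+n k) x

    p-power-order : ∀ {d f e} {ι : A → Fin (p ℕ.^ d)} → Injective _≡_ _≡_ ι →
                    (∀ x → iterate σ x (p ℕ.^ f) ≡ x) → d < p ℕ.^ e → ∀ x → iterate σ x (p ℕ.^ e) ≡ x
    p-power-order {d} {f} {e} ι-injective σ^p^f≡id d<p^e =
      δ^[p^e-1]≈0⇒^p^e≡id e (^ᴱ≈0-mono δ^d≈0 (<⇒≤pred d<p^e))
      where
      δ^d≈0 : δ ^ᴱ d ≈ᴱ 0ᴱ
      δ^d≈0 = nilpotent⇒^dim≈0 p-prime p·x≡0 δ {p ℕ.^ f} (^p^f≡id⇒δ^p^f≈0 f σ^p^f≡id) {d} ι-injective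

module Orbits {n : ℕ} {f : Fin n → Fin n} (f-injective : Injective _≡_ _≡_ f) where

  iterate-+ : ∀ x m k → iterate f x (m ℕ.+ k) ≡ iterate f (iterate f x m) k
  iterate-+ x zero    k = refl
  iterate-+ x (suc m) k = iterate-+ (f x) m k

  iterate-injective : ∀ k → Injective _≡_ _≡_ (λ x → iterate f x k)
  iterate-injective zero    eq = eq
  iterate-injective (suc k) eq = f-injective (iterate-injective k eq)

  periodic-* : ∀ {x r} → iterate f x r ≡ x → ∀ q → iterate f x (q ℕ.* r) ≡ x
  periodic-* f^r[x]≡x zero = refl
  periodic-* {x} {r} f^r[x]≡x (suc q) = begin
    iterate f x (r ℕ.+ q ℕ.* r)         ≡⟨ iterate-+ x r (q ℕ.* r) ⟩
    iterate f (iterate f x r) (q ℕ.* r) ≡⟨ cong (λ z → iterate f z (q ℕ.* r)) f^r[x]≡x ⟩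
    iterate f x (q ℕ.* r)               ≡⟨ periodic-* f^r[x]≡x q ⟩
    x                                   ∎
    where open ≡-Reasoning

  periodic-% : ∀ {x r} .{{_ : NonZero r}} → iterate f x r ≡ x → ∀ k → iterate f x k ≡ iterate f x (k % r)
  periodic-% {x} {r} f^r[x]≡x k = begin
    iterate f x k                                   ≡⟨ cong (iterate f x) k≡[k/r]*r+k%r ⟩
    iterate f x ((k / r) ℕ.* r ℕ.+ k % r)           ≡⟨ iterate-+ x ((k / r) ℕ.* r) (k % r) ⟩
    iterate f (iterate f x ((k / r) ℕ.* r)) (k % r)
      ≡⟨ cong (λ z → iterate f z (k % r)) (periodic-* f^r[x]≡x (k / r)) ⟩
    iterate f x (k % r)                             ∎
    where
    open ≡-Reasoning
    k≡[k/r]*r+k%r : k ≡ (k / r) ℕ.* r ℕ.+ k % r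
    k≡[k/r]*r+k%r = trans (m≡m%n+[m/n]*n k r) (ℕₚ.+-comm (k % r) _)

  returns : ∀ x → ∃[ r ] 0 < r × r ≤ n × iterate f x r ≡ x
  returns x with i , j , i<j , f^i[x]≡f^j[x] ← pigeonhole (n<1+n n) (λ i → iterate f x (toℕ i)) =
    r , m<n⇒0<n∸m i<j , ≤-trans (m∸n≤m (toℕ j) (toℕ i)) (ℕ.s≤s⁻¹ (toℕ<n j)) ,
    iterate-injective (toℕ i) (begin
      iterate f (iterate f x r) (toℕ i)  ≡⟨ iterate-+ x r (toℕ i) ⟨
      iterate f x (r ℕ.+ toℕ i)          ≡⟨ cong (iterate f x) (m∸n+n≡m (<⇒≤ i<j)) ⟩
      iterate f x (toℕ j)                ≡⟨ f^i[x]≡f^j[x] ⟨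
      iterate f x (toℕ i)                ∎)
    where
    open ≡-Reasoning
    r = toℕ j ∸ toℕ i

  module _ {x₀ : Fin n} (x₀-orbit : ∀ y → ∃[ k ] iterate f x₀ k ≡ y) where

    period-bound : ∀ {r} → 0 < r → iterate f x₀ r ≡ x₀ → n ≤ r
    period-bound {r} r>0 f^r[x₀]≡x₀ = injective⇒≤ {f = k%r} k%r-injective
      where
      instance _ = >-nonZero r>0
      k : Fin n → ℕ
      k y = proj₁ (x₀-orbit y)
      k%r : Fin n → Fin r
      k%r y = fromℕ< (m%n<n (k y) r)
      k%r-injective : Injective _≡_ _≡_ k%r
      k%r-injective {y} {z} k%r[y]≡k%r[z] = begin
        y                       ≡⟨ proj₂ (x₀-orbit y) ⟨
        iterate f x₀ (k y)      ≡⟨ periodic-% {r = r} f^r[x₀]≡x₀ (k y) ⟩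
        iterate f x₀ (k y % r)  ≡⟨ cong (iterate f x₀) k[y]%r≡k[z]%r ⟩
        iterate f x₀ (k z % r)  ≡⟨ periodic-% {r = r} f^r[x₀]≡x₀ (k z) ⟨
        iterate f x₀ (k z)      ≡⟨ proj₂ (x₀-orbit z) ⟩
        z                       ∎
        where
        open ≡-Reasoning
        k[y]%r≡k[z]%r : k y % r ≡ k z % r
        k[y]%r≡k[z]%r = trans (sym (toℕ-fromℕ< (m%n<n (k y) r)))
                              (trans (cong toℕ k%r[y]≡k%r[z]) (toℕ-fromℕ< (m%n<n (k z) r)))

    iterate-n≡id : ∀ y → iterate f y n ≡ y
    iterate-n≡id y with r , r>0 , r≤n , f^r[x₀]≡x₀ ← returns x₀
                     | k , f^k[x₀]≡y ← x₀-orbit y = begin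
      iterate f y n                 ≡⟨ cong (λ z → iterate f z n) f^k[x₀]≡y ⟨
      iterate f (iterate f x₀ k) n  ≡⟨ iterate-+ x₀ k n ⟨
      iterate f x₀ (k ℕ.+ n)        ≡⟨ cong (iterate f x₀) (ℕₚ.+-comm k n) ⟩
      iterate f x₀ (n ℕ.+ k)        ≡⟨ iterate-+ x₀ n k ⟩
      iterate f (iterate f x₀ n) k  ≡⟨ cong (λ z → iterate f z k) f^n[x₀]≡x₀ ⟩
      iterate f x₀ k                ≡⟨ f^k[x₀]≡y ⟩
      y                             ∎
      where
      open ≡-Reasoning
      f^n[x₀]≡x₀ : iterate f x₀ n ≡ x₀
      f^n[x₀]≡x₀ = subst (λ s → iterate f x₀ s ≡ x₀)
                         (ℕₚ.≤-antisym r≤n (period-bound r>0 f^r[x₀]≡x₀)) f^r[x₀]≡x₀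

⟨$⟩ʳ-injective : ∀ {n} (π : Perm n) → Injective _≡_ _≡_ (π ⟨$⟩ʳ_)
⟨$⟩ʳ-injective π πx≡πy =
  trans (sym (Permutation.inverseˡ π)) (trans (cong (π ⟨$⟩ˡ_) πx≡πy) (Permutation.inverseˡ π))

^ₚ-iterate : ∀ {n} (π : Perm n) k x → (π ^ₚ k) ⟨$⟩ʳ x ≡ iterate (π ⟨$⟩ʳ_) x k
^ₚ-iterate π zero    x = refl
^ₚ-iterate π (suc k) x = ^ₚ-iterate π k (π ⟨$⟩ʳ x)

module Translations {m : ℕ} {N : Perm m → Set} (N-subgroup : IsSubgroup N) (N-regular : Regular N)
                    (N-abelian : ∀ {π ρ} → N π → N ρ → (π ∘ₚ ρ) ≈ₚ (ρ ∘ₚ π)) (o : Fin m) where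

  open IsSubgroup N-subgroup

  determined-at-o : ∀ {π ρ} → N π → N ρ → π ⟨$⟩ʳ o ≡ ρ ⟨$⟩ʳ o → π ≈ₚ ρ
  determined-at-o {π} {ρ} π∈N ρ∈N πo≡ρo z = begin
    π ⟨$⟩ʳ z                    ≡⟨ Permutation.inverseʳ ρ ⟨
    ρ ⟨$⟩ʳ (ρ ⟨$⟩ˡ (π ⟨$⟩ʳ z))  ≡⟨ cong (ρ ⟨$⟩ʳ_) (proj₂ N-regular (∘∈ π∈N (inv∈ ρ∈N)) o ρ⁻¹πo≡o z) ⟩
    ρ ⟨$⟩ʳ z                    ∎
    where
    open ≡-Reasoning
    ρ⁻¹πo≡o : ρ ⟨$⟩ˡ (π ⟨$⟩ʳ o) ≡ o
    ρ⁻¹πo≡o = trans (cong (ρ ⟨$⟩ˡ_) πo≡ρo) (Permutation.inverseˡ ρ)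

  τ : Fin m → Perm m
  τ x = proj₁ (proj₁ N-regular o x)

  τ∈N : ∀ x → N (τ x)
  τ∈N x = proj₁ (proj₂ (proj₁ N-regular o x))

  τ-o : ∀ x → τ x ⟨$⟩ʳ o ≡ x
  τ-o x = proj₂ (proj₂ (proj₁ N-regular o x))

  infixl 6 _+_
  _+_ : Fin m → Fin m → Fin m
  x + y = τ x ⟨$⟩ʳ y

  -_ : Fin m → Fin m
  - x = τ x ⟨$⟩ˡ o

  τ-o≈id : τ o ≈ₚ idₚ
  τ-o≈id = determined-at-o (τ∈N o) id∈ (τ-o o)

  τ-+ : ∀ x y → τ (x + y) ≈ₚ (τ y ∘ₚ τ x)
  τ-+ x y = determined-at-o (τ∈N (x + y)) (∘∈ (τ∈N y) (τ∈N x))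
                            (trans (τ-o (x + y)) (cong (τ x ⟨$⟩ʳ_) (sym (τ-o y))))

  +-comm : ∀ x y → x + y ≡ y + x
  +-comm x y = begin
    τ x ⟨$⟩ʳ y             ≡⟨ cong (τ x ⟨$⟩ʳ_) (τ-o y) ⟨
    τ x ⟨$⟩ʳ (τ y ⟨$⟩ʳ o)  ≡⟨ N-abelian (τ∈N y) (τ∈N x) o ⟩
    τ y ⟨$⟩ʳ (τ x ⟨$⟩ʳ o)  ≡⟨ cong (τ y ⟨$⟩ʳ_) (τ-o x) ⟩
    τ y ⟨$⟩ʳ x             ∎
    where open ≡-Reasoning

  isAbelianGroup : IsAbelianGroup _≡_ _+_ o -_
  isAbelianGroup = record
    { isGroup = record
      { isMonoid = record
        { isSemigroup = record
          { isMagma = record { isEquivalence = isEquivalence ; ∙-cong = cong₂ _+_ }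
          ; assoc = τ-+
          }
        ; identity = τ-o≈id , τ-o
        }
      ; inverse = (λ x → trans (+-comm (- x) x) (Permutation.inverseʳ (τ x)))
                , (λ x → Permutation.inverseʳ (τ x))
      ; ⁻¹-cong = cong -_
      }
    ; comm = +-comm
    }

  open Endomorphisms isAbelianGroup using (_·_)

  τ-^ₚ : ∀ n x y → (τ x ^ₚ n) ⟨$⟩ʳ y ≡ n · x + y
  τ-^ₚ zero    x y = sym (τ-o≈id y)
  τ-^ₚ (suc n) x y = begin
    (τ x ^ₚ n) ⟨$⟩ʳ (x + y)  ≡⟨ τ-^ₚ n x (x + y) ⟩
    n · x + (x + y)          ≡⟨ τ-+ (n · x) x y ⟨
    n · x + x + y            ≡⟨ cong (_+ y) (+-comm (n · x) x) ⟩
    x + n · x + y            ∎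
    where open ≡-Reasoning

  exponent⇒p·x≡o : ∀ {p} → (∀ {π} → N π → (π ^ₚ p) ≈ₚ idₚ) → ∀ x → p · x ≡ o
  exponent⇒p·x≡o {p} N-exponent x = begin
    p · x              ≡⟨ τ-o (p · x) ⟨
    p · x + o          ≡⟨ τ-^ₚ p x o ⟨
    (τ x ^ₚ p) ⟨$⟩ʳ o  ≡⟨ N-exponent (τ∈N x) o ⟩
    o                  ∎
    where open ≡-Reasoning

  conjugate : Perm m → Fin m → Fin m
  conjugate g x = g ⟨$⟩ʳ (τ x ⟨$⟩ʳ (g ⟨$⟩ˡ o))

  normaliser-affine : ∀ {g : Perm m} → (∀ {π} → N π → N (flipₚ g ∘ₚ (π ∘ₚ g))) →
                      ∀ x y → g ⟨$⟩ʳ (x + y) ≡ conjugate g x + (g ⟨$⟩ʳ y)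
  normaliser-affine {g} g-normalises x y = begin
    g ⟨$⟩ʳ (τ x ⟨$⟩ʳ y)                    ≡⟨ cong (λ z → g ⟨$⟩ʳ (τ x ⟨$⟩ʳ z)) (Permutation.inverseˡ g) ⟨
    g ⟨$⟩ʳ (τ x ⟨$⟩ʳ (g ⟨$⟩ˡ (g ⟨$⟩ʳ y)))  ≡⟨ determined-at-o (g-normalises (τ∈N x)) (τ∈N (conjugate g x))
                                                              (sym (τ-o (conjugate g x))) (g ⟨$⟩ʳ y) ⟩
    τ (conjugate g x) ⟨$⟩ʳ (g ⟨$⟩ʳ y)      ∎
    where open ≡-Reasoning

-- Imported only here: Data.Nat's _^_ would clash with the semiring powers above.
open import Data.Nat using (_^_)

lemma2p2 : (p d : ℕ) → Prime p → 2 ≤ d → ¬ (p ≡ 2 × d ≡ 2) →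
           (G : Perm (p ^ d) → Set) → IsSubgroup G → Transitive G →
           (Σ (Perm (p ^ d) → Set) λ C → IsSubgroup C × C ⊆ₚ G × Cyclic C × Transitive C) →
           ¬ (Σ (Perm (p ^ d) → Set) λ N →
                IsSubgroup N × N ⊆ₚ G × Normal N G × Regular N × ElementaryAbelian p N)
lemma2p2 p (suc e) p-prime (s≤s 1≤e) ¬[p≡2×d≡2] _ _ _
  (_ , _ , C⊆G , (σ , σ∈C , σ-generates) , C-transitive)
  (_ , N-subgroup , _ , N-normal , N-regular , N-abelian , N-exponent) =
  <⇒≱ (^-monoʳ-< p (prime⇒1<p p-prime) (n<1+n e)) (period-bound σ-orbit (m^n>0 p e) (σ^p^e≡id o))
  where
  instance _ = prime⇒nonZero p-prime
  o : Fin (p ^ suc e)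
  o = fromℕ< (m^n>0 p (suc e))
  open Translations N-subgroup N-regular N-abelian o
  open Orbits (⟨$⟩ʳ-injective σ) using (period-bound; iterate-n≡id)
  open AffineMaps isAbelianGroup using (p-power-order)
  σ-orbit : ∀ y → ∃[ k ] iterate (σ ⟨$⟩ʳ_) o k ≡ y
  σ-orbit y with π , π∈C , πo≡y ← C-transitive o y
            with k , π≈σ^k ← σ-generates π∈C
            = k , trans (sym (^ₚ-iterate σ k o)) (trans (sym (π≈σ^k o)) πo≡y)
  σ^p^e≡id : ∀ x → iterate (σ ⟨$⟩ʳ_) x (p ^ e) ≡ x
  σ^p^e≡id = p-power-order p-prime (exponent⇒p·x≡o {p} N-exponent) (σ ⟨$⟩ʳ_) (conjugate σ)
               (normaliser-affine {σ} (N-normal (C⊆G σ∈C))) {d = suc e} {f = suc e} {e = e}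
               {ι = id} id (iterate-n≡id σ-orbit) (1+e<p^e p-prime 1≤e ¬[p≡2×d≡2])
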